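{- For $j,k \in \{1,2\}$, $$ N(I_1) \beta_j \gamma_k = (a_{2jk}) \overline{\alpha_1} + (a_{1jk}) (-\overline{\alpha_2}). $$ Equivalently, we have $$N(I_1)(y_1\beta_1+y_2\beta_2)(z_1\gamma_1+z_2\gamma_2)= A(\underline{e}_2, \underline{y},\underline{z})\overline{\alpha_1} + A(\underline{e}_1, \underline{y},\underline{z}) (-\overline{\alpha_2}) $$ for $\underline{y}=(y_1,y_2)^t, \underline{z}=(z_1,z_2)^t\in \mathbb{Z}^2.$
   Context: Let $D\equiv\epsilon\pmod4$, $\epsilon\in\{0,1\}$, and $S=S(D)$ the oriented quadratic ring with basis $\langle1,\tau\rangle$, $\tau^2=\epsilon\tau+\frac{D-\epsilon}{4}$. Let $A=(a_{ijk})\in\mathbb{Z}^2\otimes\mathbb{Z}^2\otimes\mathbb{Z}^2$ be a nondegenerate cube corresponding under Bhargava's bijection to a balanced triple of oriented ideals $(I_1,I_2,I_3)$ of $S$, with oriented $\mathbb{Z}$-bases $\langle\alpha_1,\alpha_2\rangle,\langle\beta_1,\beta_2\rangle,\langle\gamma_1,\gamma_2\rangle$ of $I_1,I_2,I_3$ compatible with $A$, i.e. $\alpha_i\beta_j\gamma_k=a'_{ijk}+a_{ijk}\tau$ for some integers $a'_{ijk}$. Here $\overline{\cdot}$ is conjugation in $S\otimes\mathbb{Q}$, $N(I_1)$ is the norm of the oriented ideal, $A(\underline{x},\underline{y},\underline{z})=\sum a_{ijk}x_iy_jz_k$, and $\underline{e}_1,\underline{e}_2$ are the standard basis vectors of $\mathbb{Z}^2$.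 -}

module Defs where

open import Data.Integer as ℤ using (ℤ; +_)
open import Data.Integer.Divisibility using (_∣_)
open import Data.Rational as ℚ using (ℚ; _/_)
import Data.Nat
open import Data.Fin using (Fin; zero; suc)
open import Data.Product using (Σ; ∃; _×_; _,_)
open import Data.Sum using (_⊎_)
open import Relation.Binary.PropositionalEquality using (_≡_)
open import Relation.Nullary using (¬_)

ι : ℤ → ℚ
ι z = z / 1

-- Indices 1,2 are represented by Fin 2 : zero ↦ 1, suc zero ↦ 2.
𝟏 𝟐 : Fin 2
𝟏 = zero
𝟐 = suc zero

-- Elements x + y τ of S ⊗ ℚ = ℚ(√D) (or ℚ[τ] in general), in the basis ⟨1,τ⟩.
record K : Set where
  constructor _⊕_τ
  field
    re : ℚ
    im : ℚ
open K public

-- The quadratic ring S(D) with τ² = ε τ + (D - ε)/4 ; D and ε are parameters.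
module Quad (D ε : ℤ) where

  c : ℚ
  c = (D ℤ.- ε) / 4

  τ : K
  τ = (ℚ.0ℚ ⊕ ℚ.1ℚ τ)

  _+K_ : K → K → K
  (a ⊕ b τ) +K (a' ⊕ b' τ) = (a ℚ.+ a') ⊕ (b ℚ.+ b') τ

  _*K_ : K → K → K
  (a ⊕ b τ) *K (a' ⊕ b' τ) =
    (a ℚ.* a' ℚ.+ b ℚ.* b' ℚ.* c) ⊕ (a ℚ.* b' ℚ.+ b ℚ.* a' ℚ.+ b ℚ.* b' ℚ.* ι ε) τ

  _·K_ : ℚ → K → K
  q ·K (a ⊕ b τ) = (q ℚ.* a) ⊕ (q ℚ.* b) τ

  -K_ : K → K
  -K (a ⊕ b τ) = (ℚ.- a) ⊕ (ℚ.- b) τ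

  -- conjugation: τ̄ = ε - τ, so conj(a + bτ) = (a + bε) - bτ
  conj : K → K
  conj (a ⊕ b τ) = (a ℚ.+ b ℚ.* ι ε) ⊕ (ℚ.- b) τ

  intK : ℤ → ℤ → K
  intK m n = ι m ⊕ ι n τ

  InS : K → Set
  InS x = ∃ λ m → ∃ λ n → x ≡ intK m n

  lin : (Fin 2 → K) → ℤ → ℤ → K
  lin α m n = (ι m ·K α 𝟏) +K (ι n ·K α 𝟐)

  -- Norm of the oriented ideal with oriented basis ⟨α₁,α₂⟩:
  -- the determinant of the matrix expressing ⟨α₁,α₂⟩ in terms of ⟨1,τ⟩,
  -- α₁ = p + qτ, α₂ = r + sτ  ↦  N = ps - qr.
  N : (Fin 2 → K) → ℚ
  N α = re (α 𝟏) ℚ.* im (α 𝟐) ℚ.- im (α 𝟏) ℚ.* re (α 𝟐)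

  -- ⟨α₁,α₂⟩ is a ℤ-basis of a (fractional) ideal I = ℤα₁ + ℤα₂ of S,
  -- with the orientation carried by the basis: the α's are linearly
  -- independent over ℚ and I is stable under multiplication by τ
  -- (hence by S = ℤ + ℤτ).
  IsOrientedIdealBasis : (Fin 2 → K) → Set
  IsOrientedIdealBasis α =
    ¬ (N α ≡ ℚ.0ℚ) ×
    ((i : Fin 2) → ∃ λ m → ∃ λ n → τ *K α i ≡ lin α m n)

  -- Balanced triple: I₁ I₂ I₃ ⊆ S and N(I₁) N(I₂) N(I₃) = 1.
  -- (I₁I₂I₃ is generated as a ℤ-module by the products αᵢβⱼγₖ.)
  IsBalanced : (Fin 2 → K) → (Fin 2 → K) → (Fin 2 → K) → Set
  IsBalanced α β γ =
    ((i j k : Fin 2) → InS ((α i *K β j) *K γ k)) ×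
    (N α ℚ.* N β ℚ.* N γ ≡ ℚ.1ℚ)

  Compatible : (Fin 2 → Fin 2 → Fin 2 → ℤ) →
               (Fin 2 → K) → (Fin 2 → K) → (Fin 2 → K) → Set
  Compatible A α β γ =
    (i j k : Fin 2) → ∃ λ a' → (α i *K β j) *K γ k ≡ intK a' (A i j k)

Cube : Set
Cube = Fin 2 → Fin 2 → Fin 2 → ℤ

-- Bhargava's discriminant of a cube (Cayley hyperdeterminant)
disc : Cube → ℤ
disc A =
  (a 0 0 0 ℤ.* a 1 1 1) ^2 ℤ.+ (a 0 0 1 ℤ.* a 1 1 0) ^2
  ℤ.+ (a 0 1 0 ℤ.* a 1 0 1) ^2 ℤ.+ (a 1 0 0 ℤ.* a 0 1 1) ^2
  ℤ.- + 2 ℤ.* ( a 0 0 0 ℤ.* a 1 1 1 ℤ.* a 0 0 1 ℤ.* a 1 1 0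
              ℤ.+ a 0 0 0 ℤ.* a 1 1 1 ℤ.* a 0 1 0 ℤ.* a 1 0 1
              ℤ.+ a 0 0 0 ℤ.* a 1 1 1 ℤ.* a 1 0 0 ℤ.* a 0 1 1
              ℤ.+ a 0 0 1 ℤ.* a 1 1 0 ℤ.* a 0 1 0 ℤ.* a 1 0 1
              ℤ.+ a 0 0 1 ℤ.* a 1 1 0 ℤ.* a 1 0 0 ℤ.* a 0 1 1
              ℤ.+ a 0 1 0 ℤ.* a 1 0 1 ℤ.* a 1 0 0 ℤ.* a 0 1 1 )
  ℤ.+ + 4 ℤ.* ( a 0 0 0 ℤ.* a 0 1 1 ℤ.* a 1 0 1 ℤ.* a 1 1 0
              ℤ.+ a 0 0 1 ℤ.* a 0 1 0 ℤ.* a 1 0 0 ℤ.* a 1 1 1 )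
  where
    _^2 : ℤ → ℤ
    x ^2 = x ℤ.* x
    f : Data.Nat.ℕ → Fin 2
    f 0 = zero
    f _ = suc zero
    a : Data.Nat.ℕ → Data.Nat.ℕ → Data.Nat.ℕ → ℤ
    a i j k = A (f i) (f j) (f k)

Nondegenerate : Cube → Set
Nondegenerate A = ¬ (disc A ≡ + 0)

trilin : Cube → (Fin 2 → ℤ) → (Fin 2 → ℤ) → (Fin 2 → ℤ) → ℤ
trilin A x y z = Σ2 λ i → Σ2 λ j → Σ2 λ k → A i j k ℤ.* x i ℤ.* y j ℤ.* z k
  where
    Σ2 : (Fin 2 → ℤ) → ℤ
    Σ2 g = g 𝟏 ℤ.+ g 𝟐

e : Fin 2 → Fin 2 → ℤ
e zero zero = + 1
e zero (suc zero) = + 0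
e (suc zero) zero = + 0
e (suc zero) (suc zero) = + 1

{-# OPTIONS --safe #-}
-- For y ∈ K the τ-coordinate is im y = (y − ȳ)/(τ − τ̄), and for a basis ⟨α₁, α₂⟩
-- one has ᾱ₁α₂ − α₁ᾱ₂ = N(α)(τ − τ̄).  Hence N(α)·x = im(α₂x)·ᾱ₁ − im(α₁x)·ᾱ₂ for
-- every x ∈ K, a polynomial identity valid for all D and ε.  Compatibility says
-- im(αᵢβⱼγₖ) = aᵢⱼₖ, which is the first claim at x = βⱼγₖ; by trilinearity
-- im(αᵢ(Σ yⱼβⱼ)(Σ zₖγₖ)) = A(eᵢ, y, z), which is the second.
module Submission where

open import Defs
open import Data.Integer using (ℤ; +_; _-_)
open import Data.Integer.Divisibility using (_∣_)
open import Data.Fin using (Fin; zero; suc)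
open import Data.Product using (_×_; _,_; proj₁; proj₂)
open import Data.Sum using (_⊎_)
open import Relation.Binary.PropositionalEquality
  using (_≡_; refl; sym; trans; cong; cong₂; module ≡-Reasoning)

import Data.Integer as ℤ
open import Data.Integer.Properties using (*-identityˡ; *-identityʳ; +-identityˡ; +-identityʳ)
import Data.Integer.Tactic.RingSolver as ℤ-Solver
import Data.Rational as ℚ
open import Data.Rational.Properties
  using (_≟_; +-*-commutativeRing; toℚᵘ-injective; toℚᵘ-fromℚᵘ; toℚᵘ-homo-+; toℚᵘ-homo-*)
open import Data.Rational.Unnormalised using (mkℚᵘ; _≃_; *≡*)
import Data.Rational.Unnormalised as ℚᵘ
import Data.Rational.Unnormalised.Properties as ℚᵘ
open import Level using (0ℓ)
open import Relation.Nullary.Decidable using (dec⇒maybe)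
open import Tactic.RingSolver using (solve-∀)
open import Tactic.RingSolver.Core.AlmostCommutativeRing
  using (AlmostCommutativeRing; fromCommutativeRing)

-- The zero test lets the solver drop cancelling monomials; without it
-- identities such as the N·K expansion below are not recognised.
ℚ-ring : AlmostCommutativeRing 0ℓ 0ℓ
ℚ-ring = fromCommutativeRing +-*-commutativeRing (λ x → dec⇒maybe (ℚ.0ℚ ≟ x))

toℚᵘ-ι : ∀ a → ℚ.toℚᵘ (ι a) ≃ mkℚᵘ a 0
toℚᵘ-ι a = toℚᵘ-fromℚᵘ (mkℚᵘ a 0)

ι-homo-+ : ∀ a b → ι (a ℤ.+ b) ≡ ι a ℚ.+ ι b
ι-homo-+ a b = toℚᵘ-injective (begin-equality
  ℚ.toℚᵘ (ι (a ℤ.+ b))              ≃⟨ toℚᵘ-ι (a ℤ.+ b) ⟩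
  mkℚᵘ (a ℤ.+ b) 0                   ≃⟨ *≡* (cong (ℤ._* + 1) a+b≡a*1+b*1) ⟩
  mkℚᵘ a 0 ℚᵘ.+ mkℚᵘ b 0             ≃⟨ ℚᵘ.+-cong (toℚᵘ-ι a) (toℚᵘ-ι b) ⟨
  ℚ.toℚᵘ (ι a) ℚᵘ.+ ℚ.toℚᵘ (ι b)     ≃⟨ toℚᵘ-homo-+ (ι a) (ι b) ⟨
  ℚ.toℚᵘ (ι a ℚ.+ ι b)               ∎)
  where
  open ℚᵘ.≤-Reasoning
  a+b≡a*1+b*1 : a ℤ.+ b ≡ a ℤ.* + 1 ℤ.+ b ℤ.* + 1
  a+b≡a*1+b*1 = sym (cong₂ ℤ._+_ (*-identityʳ a) (*-identityʳ b))

ι-homo-* : ∀ a b → ι (a ℤ.* b) ≡ ι a ℚ.* ι b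
ι-homo-* a b = toℚᵘ-injective (begin-equality
  ℚ.toℚᵘ (ι (a ℤ.* b))              ≃⟨ toℚᵘ-ι (a ℤ.* b) ⟩
  mkℚᵘ a 0 ℚᵘ.* mkℚᵘ b 0             ≃⟨ ℚᵘ.*-cong (toℚᵘ-ι a) (toℚᵘ-ι b) ⟨
  ℚ.toℚᵘ (ι a) ℚᵘ.* ℚ.toℚᵘ (ι b)     ≃⟨ toℚᵘ-homo-* (ι a) (ι b) ⟨
  ℚ.toℚᵘ (ι a ℚ.* ι b)               ∎)
  where open ℚᵘ.≤-Reasoning

bilin : (Fin 2 → Fin 2 → ℤ) → (Fin 2 → ℤ) → (Fin 2 → ℤ) → ℤ
bilin M y z =
  y 𝟏 ℤ.* (z 𝟏 ℤ.* M 𝟏 𝟏 ℤ.+ z 𝟐 ℤ.* M 𝟏 𝟐) ℤ.+ y 𝟐 ℤ.* (z 𝟏 ℤ.* M 𝟐 𝟏 ℤ.+ z 𝟐 ℤ.* M 𝟐 𝟐)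

trilin-expandˡ : ∀ A x y z →
  trilin A x y z ≡ x 𝟏 ℤ.* bilin (A 𝟏) y z ℤ.+ x 𝟐 ℤ.* bilin (A 𝟐) y z
trilin-expandˡ A x y z =
  expand (A 𝟏 𝟏 𝟏) (A 𝟏 𝟏 𝟐) (A 𝟏 𝟐 𝟏) (A 𝟏 𝟐 𝟐) (A 𝟐 𝟏 𝟏) (A 𝟐 𝟏 𝟐) (A 𝟐 𝟐 𝟏) (A 𝟐 𝟐 𝟐)
         (x 𝟏) (x 𝟐) (y 𝟏) (y 𝟐) (z 𝟏) (z 𝟐)
  where
  open Data.Integer using (_+_; _*_)
  expand : ∀ a₁₁₁ a₁₁₂ a₁₂₁ a₁₂₂ a₂₁₁ a₂₁₂ a₂₂₁ a₂₂₂ x₁ x₂ y₁ y₂ z₁ z₂ →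
    ((a₁₁₁ * x₁ * y₁ * z₁ + a₁₁₂ * x₁ * y₁ * z₂) + (a₁₂₁ * x₁ * y₂ * z₁ + a₁₂₂ * x₁ * y₂ * z₂))
    + ((a₂₁₁ * x₂ * y₁ * z₁ + a₂₁₂ * x₂ * y₁ * z₂) + (a₂₂₁ * x₂ * y₂ * z₁ + a₂₂₂ * x₂ * y₂ * z₂))
    ≡ x₁ * (y₁ * (z₁ * a₁₁₁ + z₂ * a₁₁₂) + y₂ * (z₁ * a₁₂₁ + z₂ * a₁₂₂))
    + x₂ * (y₁ * (z₁ * a₂₁₁ + z₂ * a₂₁₂) + y₂ * (z₁ * a₂₂₁ + z₂ * a₂₂₂))
  expand = ℤ-Solver.solve-∀

trilin-e : ∀ A i y z → trilin A (e i) y z ≡ bilin (A i) y z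
trilin-e A zero y z = begin
  trilin A (e 𝟏) y z                                     ≡⟨ trilin-expandˡ A (e 𝟏) y z ⟩
  + 1 ℤ.* bilin (A 𝟏) y z ℤ.+ + 0 ℤ.* bilin (A 𝟐) y z   ≡⟨ cong (ℤ._+ + 0) (*-identityˡ (bilin (A 𝟏) y z)) ⟩
  bilin (A 𝟏) y z ℤ.+ + 0                               ≡⟨ +-identityʳ _ ⟩
  bilin (A 𝟏) y z                                        ∎
  where open ≡-Reasoning
trilin-e A (suc zero) y z = begin
  trilin A (e 𝟐) y z                                     ≡⟨ trilin-expandˡ A (e 𝟐) y z ⟩
  + 0 ℤ.* bilin (A 𝟏) y z ℤ.+ + 1 ℤ.* bilin (A 𝟐) y z   ≡⟨ +-identityˡ _ ⟩
  + 1 ℤ.* bilin (A 𝟐) y z                                ≡⟨ *-identityˡ _ ⟩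
  bilin (A 𝟐) y z                                        ∎
  where open ≡-Reasoning

module _ (D ε : ℤ) where
  open Quad D ε

  *K-comm : ∀ x y → x *K y ≡ y *K x
  *K-comm x y = cong₂ _⊕_τ (re-comm (re x) (im x) (re y) (im y) c)
                           (im-comm (re x) (im x) (re y) (im y) (ι ε))
    where
    open ℚ using (_+_; _*_)
    re-comm : ∀ x₀ x₁ y₀ y₁ c → x₀ * y₀ + x₁ * y₁ * c ≡ y₀ * x₀ + y₁ * x₁ * c
    re-comm = solve-∀ ℚ-ring
    im-comm : ∀ x₀ x₁ y₀ y₁ e →
      x₀ * y₁ + x₁ * y₀ + x₁ * y₁ * e ≡ y₀ * x₁ + y₁ * x₀ + y₁ * x₁ * e
    im-comm = solve-∀ ℚ-ring

  *K-assoc : ∀ x y z → (x *K y) *K z ≡ x *K (y *K z)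
  *K-assoc x y z =
    cong₂ _⊕_τ (re-assoc (re x) (im x) (re y) (im y) (re z) (im z) c (ι ε))
               (im-assoc (re x) (im x) (re y) (im y) (re z) (im z) c (ι ε))
    where
    open ℚ using (_+_; _*_)
    re-assoc : ∀ x₀ x₁ y₀ y₁ z₀ z₁ c e →
      (x₀ * y₀ + x₁ * y₁ * c) * z₀ + (x₀ * y₁ + x₁ * y₀ + x₁ * y₁ * e) * z₁ * c
      ≡ x₀ * (y₀ * z₀ + y₁ * z₁ * c) + x₁ * (y₀ * z₁ + y₁ * z₀ + y₁ * z₁ * e) * c
    re-assoc = solve-∀ ℚ-ring
    im-assoc : ∀ x₀ x₁ y₀ y₁ z₀ z₁ c e →
      (x₀ * y₀ + x₁ * y₁ * c) * z₁ + (x₀ * y₁ + x₁ * y₀ + x₁ * y₁ * e) * z₀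
        + (x₀ * y₁ + x₁ * y₀ + x₁ * y₁ * e) * z₁ * e
      ≡ x₀ * (y₀ * z₁ + y₁ * z₀ + y₁ * z₁ * e) + x₁ * (y₀ * z₀ + y₁ * z₁ * c)
        + x₁ * (y₀ * z₁ + y₁ * z₀ + y₁ * z₁ * e) * e
    im-assoc = solve-∀ ℚ-ring

  lin-cong : ∀ {b b′} m n → (∀ i → b i ≡ b′ i) → lin b m n ≡ lin b′ m n
  lin-cong m n b≡b′ = cong₂ _+K_ (cong (ι m ·K_) (b≡b′ 𝟏)) (cong (ι n ·K_) (b≡b′ 𝟐))

  *K-linearˡ : ∀ b m n w → lin b m n *K w ≡ lin (λ i → b i *K w) m n
  *K-linearˡ b m n w =
    cong₂ _⊕_τ (re-linear (ι m) (ι n) (re (b 𝟏)) (im (b 𝟏)) (re (b 𝟐)) (im (b 𝟐)) (re w) (im w) c)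
               (im-linear (ι m) (ι n) (re (b 𝟏)) (im (b 𝟏)) (re (b 𝟐)) (im (b 𝟐)) (re w) (im w) (ι ε))
    where
    open ℚ using (_+_; _*_)
    re-linear : ∀ p q x₀ x₁ y₀ y₁ w₀ w₁ c →
      (p * x₀ + q * y₀) * w₀ + (p * x₁ + q * y₁) * w₁ * c
      ≡ p * (x₀ * w₀ + x₁ * w₁ * c) + q * (y₀ * w₀ + y₁ * w₁ * c)
    re-linear = solve-∀ ℚ-ring
    im-linear : ∀ p q x₀ x₁ y₀ y₁ w₀ w₁ e →
      (p * x₀ + q * y₀) * w₁ + (p * x₁ + q * y₁) * w₀ + (p * x₁ + q * y₁) * w₁ * e
      ≡ p * (x₀ * w₁ + x₁ * w₀ + x₁ * w₁ * e) + q * (y₀ * w₁ + y₁ * w₀ + y₁ * w₁ * e)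
    im-linear = solve-∀ ℚ-ring

  *K-linearʳ : ∀ w b m n → w *K lin b m n ≡ lin (λ i → w *K b i) m n
  *K-linearʳ w b m n = begin
    w *K lin b m n             ≡⟨ *K-comm w (lin b m n) ⟩
    lin b m n *K w             ≡⟨ *K-linearˡ b m n w ⟩
    lin (λ i → b i *K w) m n   ≡⟨ lin-cong m n (λ i → *K-comm (b i) w) ⟩
    lin (λ i → w *K b i) m n   ∎
    where open ≡-Reasoning

  *K-trilinear : ∀ a b g m n p q →
    a *K (lin b m n *K lin g p q) ≡ lin (λ j → lin (λ k → (a *K b j) *K g k) p q) m n
  *K-trilinear a b g m n p q = begin
    a *K (lin b m n *K lin g p q)                       ≡⟨ *K-assoc a (lin b m n) (lin g p q) ⟨
    (a *K lin b m n) *K lin g p q                       ≡⟨ cong (_*K lin g p q) (*K-linearʳ a b m n) ⟩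
    lin (λ j → a *K b j) m n *K lin g p q               ≡⟨ *K-linearˡ (λ j → a *K b j) m n (lin g p q) ⟩
    lin (λ j → (a *K b j) *K lin g p q) m n             ≡⟨ lin-cong m n (λ j → *K-linearʳ (a *K b j) g p q) ⟩
    lin (λ j → lin (λ k → (a *K b j) *K g k) p q) m n   ∎
    where open ≡-Reasoning

  lin-intK : ∀ (r s : Fin 2 → ℤ) m n →
    lin (λ i → intK (r i) (s i)) m n ≡ intK (m ℤ.* r 𝟏 ℤ.+ n ℤ.* r 𝟐) (m ℤ.* s 𝟏 ℤ.+ n ℤ.* s 𝟐)
  lin-intK r s m n = sym (cong₂ _⊕_τ (ι-combination (r 𝟏) (r 𝟐)) (ι-combination (s 𝟏) (s 𝟐)))
    where
    ι-combination : ∀ u v → ι (m ℤ.* u ℤ.+ n ℤ.* v) ≡ ι m ℚ.* ι u ℚ.+ ι n ℚ.* ι v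
    ι-combination u v = trans (ι-homo-+ (m ℤ.* u) (n ℤ.* v)) (cong₂ ℚ._+_ (ι-homo-* m u) (ι-homo-* n v))

  N·K-expansion : ∀ α x {p q} → im (α 𝟏 *K x) ≡ p → im (α 𝟐 *K x) ≡ q →
    N α ·K x ≡ (q ·K conj (α 𝟏)) +K (p ·K (-K conj (α 𝟐)))
  N·K-expansion α x refl refl =
    cong₂ _⊕_τ (re-expansion (re (α 𝟏)) (im (α 𝟏)) (re (α 𝟐)) (im (α 𝟐)) (re x) (im x) (ι ε))
               (im-expansion (re (α 𝟏)) (im (α 𝟏)) (re (α 𝟐)) (im (α 𝟐)) (re x) (im x) (ι ε))
    where
    open ℚ using (_+_; _*_; -_)
    re-expansion : ∀ a₀ a₁ b₀ b₁ x₀ x₁ e →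
      (a₀ * b₁ + - (a₁ * b₀)) * x₀
      ≡ (b₀ * x₁ + b₁ * x₀ + b₁ * x₁ * e) * (a₀ + a₁ * e)
        + (a₀ * x₁ + a₁ * x₀ + a₁ * x₁ * e) * - (b₀ + b₁ * e)
    re-expansion = solve-∀ ℚ-ring
    im-expansion : ∀ a₀ a₁ b₀ b₁ x₀ x₁ e →
      (a₀ * b₁ + - (a₁ * b₀)) * x₁
      ≡ (b₀ * x₁ + b₁ * x₀ + b₁ * x₁ * e) * - a₁ + (a₀ * x₁ + a₁ * x₀ + a₁ * x₁ * e) * - - b₁
    im-expansion = solve-∀ ℚ-ring

  module Compatibility (A : Cube) (α β γ : Fin 2 → K) (compatible : Compatible A α β γ) where

    im-compatible : ∀ i j k → im (α i *K (β j *K γ k)) ≡ ι (A i j k)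
    im-compatible i j k = begin
      im (α i *K (β j *K γ k))   ≡⟨ cong im (*K-assoc (α i) (β j) (γ k)) ⟨
      im ((α i *K β j) *K γ k)   ≡⟨ cong im (proj₂ (compatible i j k)) ⟩
      ι (A i j k)                ∎
      where open ≡-Reasoning

    im-compatible-lin : ∀ i (y z : Fin 2 → ℤ) →
      im (α i *K (lin β (y 𝟏) (y 𝟐) *K lin γ (z 𝟏) (z 𝟐))) ≡ ι (trilin A (e i) y z)
    im-compatible-lin i y z = begin
      im (α i *K (lin β (y 𝟏) (y 𝟐) *K lin γ (z 𝟏) (z 𝟐)))
        ≡⟨ cong im (*K-trilinear (α i) β γ (y 𝟏) (y 𝟐) (z 𝟏) (z 𝟐)) ⟩
      im (lin (λ j → lin (λ k → (α i *K β j) *K γ k) (z 𝟏) (z 𝟐)) (y 𝟏) (y 𝟐))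
        ≡⟨ cong im (lin-cong (y 𝟏) (y 𝟐) λ j → lin-cong (z 𝟏) (z 𝟐) λ k → proj₂ (compatible i j k)) ⟩
      im (lin (λ j → lin (λ k → intK (a′ j k) (A i j k)) (z 𝟏) (z 𝟐)) (y 𝟏) (y 𝟐))
        ≡⟨ cong im (lin-cong (y 𝟏) (y 𝟐) λ j → lin-intK (a′ j) (A i j) (z 𝟏) (z 𝟐)) ⟩
      im (lin (λ j → intK (a′·z j) (A·z j)) (y 𝟏) (y 𝟐))
        ≡⟨ cong im (lin-intK a′·z A·z (y 𝟏) (y 𝟐)) ⟩
      ι (bilin (A i) y z)
        ≡⟨ cong ι (trilin-e A i y z) ⟨
      ι (trilin A (e i) y z)
        ∎
      where
      open ≡-Reasoning
      a′ : Fin 2 → Fin 2 → ℤ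
      a′ j k = proj₁ (compatible i j k)
      a′·z A·z : Fin 2 → ℤ
      a′·z j = z 𝟏 ℤ.* a′ j 𝟏 ℤ.+ z 𝟐 ℤ.* a′ j 𝟐
      A·z j = z 𝟏 ℤ.* A i j 𝟏 ℤ.+ z 𝟐 ℤ.* A i j 𝟐

proposition3p5 :
    (D ε : ℤ) → (ε ≡ + 0 ⊎ ε ≡ + 1) → (+ 4 ∣ (D - ε)) →
    (A : Cube) → Nondegenerate A → disc A ≡ D →
    (α β γ : Fin 2 → K) →
    Quad.IsOrientedIdealBasis D ε α →
    Quad.IsOrientedIdealBasis D ε β →
    Quad.IsOrientedIdealBasis D ε γ →
    Quad.IsBalanced D ε α β γ →
    Quad.Compatible D ε A α β γ →
    ((j k : Fin 2) →
       Quad._·K_ D ε (Quad.N D ε α) (Quad._*K_ D ε (β j) (γ k))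
       ≡ Quad._+K_ D ε
           (Quad._·K_ D ε (ι (A 𝟐 j k)) (Quad.conj D ε (α 𝟏)))
           (Quad._·K_ D ε (ι (A 𝟏 j k)) (Quad.-K_ D ε (Quad.conj D ε (α 𝟐)))))
    ×
    ((y z : Fin 2 → ℤ) →
       Quad._·K_ D ε (Quad.N D ε α)
         (Quad._*K_ D ε (Quad.lin D ε β (y 𝟏) (y 𝟐)) (Quad.lin D ε γ (z 𝟏) (z 𝟐)))
       ≡ Quad._+K_ D ε
           (Quad._·K_ D ε (ι (trilin A (e 𝟐) y z)) (Quad.conj D ε (α 𝟏)))
           (Quad._·K_ D ε (ι (trilin A (e 𝟏) y z)) (Quad.-K_ D ε (Quad.conj D ε (α 𝟐)))))
proposition3p5 D ε _ _ A _ _ α β γ _ _ _ _ compatible =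
  (λ j k → N·K-expansion D ε α _ (im-compatible 𝟏 j k) (im-compatible 𝟐 j k)) ,
  (λ y z → N·K-expansion D ε α _ (im-compatible-lin 𝟏 y z) (im-compatible-lin 𝟐 y z))
  where open Compatibility D ε A α β γ compatible
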